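{- Let $\mathsf{Var}$ be a set, and let $\mathsf{Tm}$, the map expressions $A \Rightarrow B$, $\mathsf{Nf}$, $\mathsf{nf}'$ and $\mathsf{nf}$ be as defined in the context. Then: (1) for every pair of object expressions $A, B \in \mathsf{Tm}$, every map expression $f : A \Rightarrow B$ and every $N \in \mathsf{Nf}$, we have $\mathsf{nf}'_A\,N = \mathsf{nf}'_B\,N$; (2) for every map expression $f : A \Rightarrow B$, we have $\mathsf{nf}\,A = \mathsf{nf}\,B$.
   Context: Fix a set $\mathsf{Var}$ (of "variables"). The set $\mathsf{Tm}$ of object expressions is defined inductively: for $X \in \mathsf{Var}$, $\mathsf{v}\,X \in \mathsf{Tm}$; $\mathsf{I} \in \mathsf{Tm}$; if $A, B \in \mathsf{Tm}$ then $A \otimes B \in \mathsf{Tm}$. For $A, B \in \mathsf{Tm}$, the set $A \Rightarrow B$ of map expressions is defined inductively by the rules: $\mathsf{id} : A \Rightarrow A$; if $f : B \Rightarrow C$ and $g : A \Rightarrow B$ then $f \circ g : A \Rightarrow C$; if $f : A \Rightarrow C$ and $g : B \Rightarrow D$ then $f \otimes g : A \otimes B \Rightarrow C \otimes D$; $\lambda : \mathsf{I} \otimes A \Rightarrow A$; $\rho : A \Rightarrow A \otimes \mathsf{I}$; $\alpha : (A \otimes B) \otimes C \Rightarrow A \otimes (B \otimes C)$ (for all object expressions $A,B,C,D$). The set $\mathsf{Nf}$ of normal forms is defined inductively: $\mathsf{J} \in \mathsf{Nf}$; if $X \in \mathsf{Var}$ and $N \in \mathsf{Nf}$ then $X \mathbin{`\otimes}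 N \in \mathsf{Nf}$ (so $\mathsf{Nf}$ is the set of finite lists over $\mathsf{Var}$). Define $\mathsf{nf}' : \mathsf{Tm} \to \mathsf{Nf} \to \mathsf{Nf}$, written $\mathsf{nf}'_A\,N$, recursively by $\mathsf{nf}'_{\mathsf{v}X}\,N = X \mathbin{`\otimes} N$, $\mathsf{nf}'_{\mathsf{I}}\,N = N$, $\mathsf{nf}'_{A\otimes B}\,N = \mathsf{nf}'_A(\mathsf{nf}'_B\,N)$, and $\mathsf{nf} : \mathsf{Tm} \to \mathsf{Nf}$ by $\mathsf{nf}\,A = \mathsf{nf}'_A\,\mathsf{J}$. -}

module Defs where

module _ (Var : Set) where

  infixl 6 _⊗_
  data Tm : Set where
    v   : Var → Tm
    I   : Tm
    _⊗_ : Tm → Tm → Tm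

  infix 4 _⇒_
  infixr 9 _∘_
  infixl 6 _⊗m_
  data _⇒_ : Tm → Tm → Set where
    id   : {A : Tm} → A ⇒ A
    _∘_  : {A B C : Tm} → B ⇒ C → A ⇒ B → A ⇒ C
    _⊗m_ : {A B C D : Tm} → A ⇒ C → B ⇒ D → A ⊗ B ⇒ C ⊗ D
    λ′   : {A : Tm} → I ⊗ A ⇒ A
    ρ    : {A : Tm} → A ⇒ A ⊗ I
    α    : {A B C : Tm} → (A ⊗ B) ⊗ C ⇒ A ⊗ (B ⊗ C)

  infixr 5 _`⊗_
  data Nf : Set where
    J    : Nf
    _`⊗_ : Var → Nf → Nf

  nf′ : Tm → Nf → Nf
  nf′ (v X)   N = X `⊗ N
  nf′ I       N = N
  nf′ (A ⊗ B) N = nf′ A (nf′ B N)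

  nf : Tm → Nf
  nf A = nf′ A J

-- The function nf′ A interprets an object expression A as an endofunction of
-- Nf (prepending the variables of A, read left to right): I is the identity,
-- ⊗ is composition.  In this interpretation the unitors and the associator
-- hold by computation, since composition of functions is strictly unital and
-- associative.
module Submission where

open import Defs
open import Relation.Binary.PropositionalEquality
  using (_≡_; refl; trans; cong; module ≡-Reasoning)
open import Data.Product using (_×_; _,_)

module _ (Var : Set) where

  SameNf : Tm Var → Tm Var → Set
  SameNf A B = (N : Nf Var) → nf′ Var A N ≡ nf′ Var B N

  ⊗-sameNf : {A B C D : Tm Var} → SameNf A C → SameNf B D →
             SameNf (A ⊗ B) (C ⊗ D)
  ⊗-sameNf {A} {B} {C} {D} A≈C B≈D N = begin
    nf′ Var A (nf′ Var B N)  ≡⟨ cong (nf′ Var A) (B≈D N) ⟩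
    nf′ Var A (nf′ Var D N)  ≡⟨ A≈C (nf′ Var D N) ⟩
    nf′ Var C (nf′ Var D N)  ∎
    where open ≡-Reasoning

  map-sameNf : {A B : Tm Var} → _⇒_ Var A B → SameNf A B
  map-sameNf id      N = refl
  map-sameNf (f ∘ g) N = trans (map-sameNf g N) (map-sameNf f N)
  map-sameNf (_⊗m_ {A} {B} {C} {D} f g) N =
    ⊗-sameNf {A} {B} {C} {D} (map-sameNf f) (map-sameNf g) N
  map-sameNf λ′      N = refl
  map-sameNf ρ       N = refl
  map-sameNf α       N = refl

proposition1 : (Var : Set) →
    ((A B : Tm Var) → _⇒_ Var A B → (N : Nf Var) → nf′ Var A N ≡ nf′ Var B N)
    × ((A B : Tm Var) → _⇒_ Var A B → nf Var A ≡ nf Var B)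
proposition1 Var =
  (λ A B f → map-sameNf Var f) ,
  (λ A B f → map-sameNf Var f (J))
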